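{- Let $b\ge2$, $m\ge1$ and $n\ge0$ be integers, and let $N$ be the number of base-$b$ digits of $n$. For integers $0\le k_1,\dots,k_m\le n$ define $$\binom{n}{k_1,\dots,k_m}_b=\prod_{l=0}^{N-1}\binom{n_l}{(k_1)_l,\dots,(k_m)_l},$$ where $n_l$ and $(k_i)_l$ denote the rank-$l$ base-$b$ digits of $n$ and $k_i$, and for nonnegative integers $\binom{a}{c_1,\dots,c_m}=\frac{a!}{c_1!\cdots c_m!}$ if $c_1+\cdots+c_m=a$ and $0$ otherwise. Then for all $X_1,\dots,X_m\in\mathbb{C}$, $$(X_1+\cdots+X_m)^{S_b(n)}=\sum_{0\le k_1,\dots,k_m\le n}\binom{n}{k_1,\dots,k_m}_b X_1^{S_b(k_1)}\cdots X_m^{S_b(k_m)},$$ where $S_b(j)$ is the sum of the base-$b$ digits of $j$.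
   Context: Base-$b$ digits of $j\ge0$: the unique $j_l\in\{0,\dots,b-1\}$ with $j=\sum_l j_lb^l$. Convention $0^0=1$. -}

module Defs where

open import Level using (Level)
open import Function using (_∘_)
open import Data.Bool using (if_then_else_)
open import Data.Nat using (ℕ; zero; suc; _+_; _*_; _^_; _≤?_; _≟_; _/_; _%_; _!; NonZero)
open import Data.Nat.Properties using (m^n≢0; _!≢0; m*n≢0)
open import Data.Fin using (Fin; zero; suc)
open import Relation.Nullary.Decidable using (does)
open import Algebra.Bundles using (CommutativeRing; Semiring)
import Algebra.Definitions.RawSemiring as RawSemiringDefs

sumℕ : ℕ → (ℕ → ℕ) → ℕ
sumℕ zero    f = 0
sumℕ (suc N) f = sumℕ N f + f N

prodℕ : ℕ → (ℕ → ℕ) → ℕ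
prodℕ zero    f = 1
prodℕ (suc N) f = prodℕ N f * f N

-- digit b j l = j_l, the rank-l base-b digit of j, i.e. ⌊ j / b^l ⌋ mod b
-- (for b = 0 it is set to 0; only b ≥ 2 is used).
digit : ℕ → ℕ → ℕ → ℕ
digit zero    j l = 0
digit (suc b) j l = ((j / (suc b ^ l)) {{m^n≢0 (suc b) l}}) % suc b

-- number of base-b digits of n: the number of l with b^l ≤ n
-- (for b ≥ 2 such l satisfy l ≤ n, so counting l < n+1 suffices);
-- this is 0 for n = 0 and ⌊log_b n⌋ + 1 for n ≥ 1.
numDigits : ℕ → ℕ → ℕ
numDigits b n = sumℕ (suc n) (λ l → if does (b ^ l ≤? n) then 1 else 0)

digitSum : ℕ → ℕ → ℕ
digitSum b j = sumℕ (numDigits b j) (digit b j)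

sumFin : ∀ m → (Fin m → ℕ) → ℕ
sumFin zero    c = 0
sumFin (suc m) c = c zero + sumFin m (c ∘ suc)

prodFact : ∀ m → (Fin m → ℕ) → ℕ
prodFact zero    c = 1
prodFact (suc m) c = c zero ! * prodFact m (c ∘ suc)

prodFact≢0 : ∀ m c → NonZero (prodFact m c)
prodFact≢0 zero    c = _
prodFact≢0 (suc m) c = m*n≢0 (c zero !) (prodFact m (c ∘ suc))
                         {{c zero !≢0}} {{prodFact≢0 m (c ∘ suc)}}

multinomial : ∀ m → ℕ → (Fin m → ℕ) → ℕ
multinomial m a c =
  if does (sumFin m c ≟ a)
  then (a ! / prodFact m c) {{prodFact≢0 m c}}
  else 0

baseMultinomial : (b m n : ℕ) → (Fin m → ℕ) → ℕ
baseMultinomial b m n k =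
  prodℕ (numDigits b n) (λ l → multinomial m (digit b n l) (λ i → digit b (k i) l))

module _ {c ℓ : Level} (R : CommutativeRing c ℓ) where
  open CommutativeRing R using (Carrier; semiring) renaming (_+_ to _+ᴿ_; _*_ to _*ᴿ_; 0# to 0ᴿ; 1# to 1ᴿ)

  -- x ^ e  (with x ^ 0 = 1, so 0^0 = 1)
  pow : Carrier → ℕ → Carrier
  pow = RawSemiringDefs._^_ (Semiring.rawSemiring semiring)

  natMul : ℕ → Carrier → Carrier
  natMul = RawSemiringDefs._×_ (Semiring.rawSemiring semiring)

  finSum : ∀ m → (Fin m → Carrier) → Carrier
  finSum zero    f = 0ᴿ
  finSum (suc m) f = f zero +ᴿ finSum m (f ∘ suc)

  finProd : ∀ m → (Fin m → Carrier) → Carrier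
  finProd zero    f = 1ᴿ
  finProd (suc m) f = f zero *ᴿ finProd m (f ∘ suc)

  rangeSum : ℕ → (ℕ → Carrier) → Carrier
  rangeSum zero    g = 0ᴿ
  rangeSum (suc N) g = rangeSum N g +ᴿ g N

  boxSum : ∀ m → ℕ → ((Fin m → ℕ) → Carrier) → Carrier
  boxSum zero    n F = F (λ ())
  boxSum (suc m) n F =
    rangeSum (suc n) (λ j → boxSum m n (λ k → F (λ { zero → j ; (suc i) → k i })))

-- Write n = Σ_{l<N} n_l b^l.  Then (X₁ + ⋯ + X_m)^(S_b(n)) = ∏_l (X₁ + ⋯ + X_m)^(n_l), and since n_l < b the
-- multinomial theorem expands each factor as a sum over exponent vectors in [0, b)^m.  Reading the exponent
-- vector of the l-th factor as the rank-l digits of (k₁, …, k_m) turns the product of these N sums into a single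
-- sum over k ∈ [0, b^N)^m whose coefficient is the base-b multinomial coefficient and whose monomial has
-- exponents S_b(k_i).  A nonzero coefficient forces every digit of each k_i to be at most the corresponding
-- digit of n, hence k_i ≤ n, so the sum can be cut down to [0, n]^m.

module Submission where

open import Defs
open import Level using (Level)
open import Function using (_∘_)
open import Data.Empty using (⊥-elim)
open import Data.Sum using (_⊎_; inj₁; inj₂)
open import Data.Product using (∃; _,_)
open import Data.Bool using (if_then_else_)
open import Data.Nat as Nat
  using (ℕ; zero; suc; z≤n; s≤s; _≤_; _<_; _≰_; _!; NonZero; _/_; _%_; _≟_; _≤?_)
open import Data.Nat.Properties as ℕₚ
  using (≤-refl; ≤-trans; <-≤-trans; ≤-<-trans; m<n⇒m<1+n; m≤n⇒m<n∨m≡n; ≰⇒>)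
open import Data.Nat.Divisibility using (_∣_; 1∣_; ∣-trans; *-monoʳ-∣; n∣m*n)
open import Data.Nat.DivMod
  using (m≡m%n+[m/n]*n; [m+kn]%n≡m%n; m%n<n; m<n⇒m%n≡m; m<n⇒m/n≡0; m<n*o⇒m/o<n;
         m*n/m*o≡n/o; *-/-assoc; /-congˡ; /-congʳ; m/n*n≡m; +-distrib-/-∣ʳ; m*n/n≡m)
open import Data.Nat.Combinatorics using (_C_; k![n∸k]!∣n!; k>n⇒nCk≡0; nCk≡n!/k![n-k]!)
open import Data.Fin using (Fin; zero; suc; toℕ; fromℕ; inject₁)
open import Data.Fin.Properties using (toℕ-inject₁; toℕ-fromℕ)
open import Data.Vec.Functional using ([]; _∷_)
open import Relation.Binary.Core using (_Preserves_⟶_)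
open import Relation.Binary.PropositionalEquality
  using (_≡_; _≢_; _≗_; refl; sym; trans; cong; cong₂; subst; subst₂; module ≡-Reasoning)
open import Relation.Nullary using (yes; no; does)
open import Relation.Nullary.Decidable using (dec-true; dec-false)
open import Algebra.Bundles using (CommutativeRing)
open import Algebra.Properties.CommutativeSemigroup ℕₚ.*-commutativeSemigroup using (x∙yz≈y∙xz)

module _ where
  open Nat using (_+_; _*_; _∸_; _^_)

  sumℕ-cong : ∀ N {f g : ℕ → ℕ} → (∀ l → l < N → f l ≡ g l) → sumℕ N f ≡ sumℕ N g
  sumℕ-cong zero    f≡g = refl
  sumℕ-cong (suc N) f≡g = cong₂ _+_ (sumℕ-cong N (λ l l<N → f≡g l (m<n⇒m<1+n l<N))) (f≡g N ≤-refl)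

  prodℕ-cong : ∀ N {f g : ℕ → ℕ} → (∀ l → l < N → f l ≡ g l) → prodℕ N f ≡ prodℕ N g
  prodℕ-cong zero    f≡g = refl
  prodℕ-cong (suc N) f≡g = cong₂ _*_ (prodℕ-cong N (λ l l<N → f≡g l (m<n⇒m<1+n l<N))) (f≡g N ≤-refl)

  sumℕ-mono-≤ : ∀ N {f g : ℕ → ℕ} → (∀ l → l < N → f l ≤ g l) → sumℕ N f ≤ sumℕ N g
  sumℕ-mono-≤ zero    f≤g = z≤n
  sumℕ-mono-≤ (suc N) f≤g = ℕₚ.+-mono-≤ (sumℕ-mono-≤ N (λ l l<N → f≤g l (m<n⇒m<1+n l<N))) (f≤g N ≤-refl)

  sumℕ-extend : ∀ {L} M (f : ℕ → ℕ) → L ≤ M → (∀ l → L ≤ l → f l ≡ 0) → sumℕ M f ≡ sumℕ L f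
  sumℕ-extend zero    f z≤n     _  = refl
  sumℕ-extend (suc M) f L≤1+M f≡0 with m≤n⇒m<n∨m≡n L≤1+M
  ... | inj₂ refl       = refl
  ... | inj₁ (s≤s L≤M) =
    trans (cong₂ _+_ (sumℕ-extend M f L≤M f≡0) (f≡0 M L≤M)) (ℕₚ.+-identityʳ _)

  prodℕ≢0⇒≢0 : ∀ N (f : ℕ → ℕ) → prodℕ N f ≢ 0 → ∀ l → l < N → f l ≢ 0
  prodℕ≢0⇒≢0 (suc N) f ∏≢0 l l<1+N fl≡0 with m≤n⇒m<n∨m≡n l<1+N
  ... | inj₁ (s≤s l<N) = prodℕ≢0⇒≢0 N f (λ ∏≡0 → ∏≢0 (cong (_* f N) ∏≡0)) l l<N fl≡0
  ... | inj₂ refl      = ∏≢0 (trans (cong (prodℕ N f *_) fl≡0) (ℕₚ.*-zeroʳ (prodℕ N f)))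

  sumFin-cong : ∀ m {c c' : Fin m → ℕ} → c ≗ c' → sumFin m c ≡ sumFin m c'
  sumFin-cong zero    c≗c' = refl
  sumFin-cong (suc m) c≗c' = cong₂ _+_ (c≗c' zero) (sumFin-cong m (c≗c' ∘ suc))

  prodFact-cong : ∀ m {c c' : Fin m → ℕ} → c ≗ c' → prodFact m c ≡ prodFact m c'
  prodFact-cong zero    c≗c' = refl
  prodFact-cong (suc m) c≗c' = cong₂ (λ x y → x ! * y) (c≗c' zero) (prodFact-cong m (c≗c' ∘ suc))

  ≤-sumFin : ∀ m (c : Fin m → ℕ) i → c i ≤ sumFin m c
  ≤-sumFin (suc m) c zero    = ℕₚ.m≤m+n (c zero) _
  ≤-sumFin (suc m) c (suc i) = ≤-trans (≤-sumFin m (c ∘ suc) i) (ℕₚ.m≤n+m _ (c zero))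

  prodFact∣! : ∀ m (c : Fin m → ℕ) → prodFact m c ∣ sumFin m c !
  prodFact∣! zero    c = 1∣ 1
  prodFact∣! (suc m) c = ∣-trans (*-monoʳ-∣ (c zero !) P∣[s∸c₀]!) (k![n∸k]!∣n! (ℕₚ.m≤m+n (c zero) s))
    where
    s : ℕ
    s = sumFin m (c ∘ suc)
    P∣[s∸c₀]! : prodFact m (c ∘ suc) ∣ (c zero + s ∸ c zero) !
    P∣[s∸c₀]! = subst (λ t → prodFact m (c ∘ suc) ∣ t !) (sym (ℕₚ.m+n∸m≡n (c zero) s))
                      (prodFact∣! m (c ∘ suc))

  multinomial-cong : ∀ m a {c c' : Fin m → ℕ} → c ≗ c' → multinomial m a c ≡ multinomial m a c'
  multinomial-cong m a {c} {c'} c≗c' rewrite sumFin-cong m c≗c' =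
    cong (λ x → if does (sumFin m c' ≟ a) then x else 0)
         (/-congʳ {{prodFact≢0 m c}} {{prodFact≢0 m c'}} (prodFact-cong m c≗c'))

  multinomial-yes : ∀ m a (c : Fin m → ℕ) (Σc≡a : sumFin m c ≡ a) →
    multinomial m a c ≡ (a ! / prodFact m c) {{prodFact≢0 m c}}
  multinomial-yes m a c Σc≡a = cong (λ t → if t then (a ! / prodFact m c) {{prodFact≢0 m c}} else 0)
                                (dec-true (sumFin m c ≟ a) Σc≡a)

  multinomial-no : ∀ m a (c : Fin m → ℕ) → sumFin m c ≢ a → multinomial m a c ≡ 0
  multinomial-no m a c Σc≢a = cong (λ t → if t then (a ! / prodFact m c) {{prodFact≢0 m c}} else 0)
                               (dec-false (sumFin m c ≟ a) Σc≢a)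

  multinomial≢0⇒sumFin≡ : ∀ m a (c : Fin m → ℕ) → multinomial m a c ≢ 0 → sumFin m c ≡ a
  multinomial≢0⇒sumFin≡ m a c mult≢0 with sumFin m c ≟ a
  ... | yes Σc≡a = Σc≡a
  ... | no  Σc≢a = ⊥-elim (mult≢0 (multinomial-no m a c Σc≢a))

  [j+s]!/[j!*P]≡[j+s]Cj*[s!/P] : ∀ j s P .{{_ : NonZero P}} .{{_ : NonZero (j ! * P)}} → P ∣ s ! →
    (j + s) ! / (j ! * P) ≡ ((j + s) C j) * (s ! / P)
  [j+s]!/[j!*P]≡[j+s]Cj*[s!/P] j s P P∣s! = begin
    (j + s) ! / (j ! * P)                 ≡⟨ /-congˡ [j+s]!≡j!*[j+s]Cj*s! ⟩
    j ! * (((j + s) C j) * s !) / (j ! * P) ≡⟨ m*n/m*o≡n/o (j !) _ P ⟩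
    ((j + s) C j) * s ! / P                 ≡⟨ *-/-assoc ((j + s) C j) P∣s! ⟩
    ((j + s) C j) * (s ! / P)               ∎
    where
    open ≡-Reasoning
    instance
      j!≢0 : NonZero (j !)
      j!≢0 = j ℕₚ.!≢0
    [j+s]!≡j!*[j+s]Cj*s! : (j + s) ! ≡ j ! * (((j + s) C j) * s !)
    [j+s]!≡j!*[j+s]Cj*s! = begin
      (j + s) !                                     ≡⟨ m/n*n≡m (k![n∸k]!∣n! j≤j+s) ⟨
      (j + s) ! / (j ! * (j + s ∸ j) !) * (j ! * (j + s ∸ j) !)
        ≡⟨ cong₂ _*_ (sym (nCk≡n!/k![n-k]! j≤j+s)) (cong (λ t → j ! * t !) (ℕₚ.m+n∸m≡n j s)) ⟩
      ((j + s) C j) * (j ! * s !)                   ≡⟨ x∙yz≈y∙xz ((j + s) C j) (j !) (s !) ⟩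
      j ! * (((j + s) C j) * s !)                   ∎
      where
      j≤j+s : j ≤ j + s
      j≤j+s = ℕₚ.m≤m+n j s
      instance
        j!*[j+s∸j]!≢0 : NonZero (j ! * (j + s ∸ j) !)
        j!*[j+s∸j]!≢0 = ℕₚ.m*n≢0 (j !) ((j + s ∸ j) !) {{j ℕₚ.!≢0}} {{(j + s ∸ j) ℕₚ.!≢0}}

  multinomial-cons : ∀ m a j (c : Fin m → ℕ) →
    multinomial (suc m) a (j ∷ c) ≡ (a C j) * multinomial m (a ∸ j) c
  multinomial-cons m a j c with j + sumFin m c ≟ a
  ... | yes refl = begin
    multinomial (suc m) (j + s) (j ∷ c)
      ≡⟨ multinomial-yes (suc m) (j + s) (j ∷ c) refl ⟩
    (j + s) ! / (j ! * prodFact m c)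
      ≡⟨ [j+s]!/[j!*P]≡[j+s]Cj*[s!/P] j s (prodFact m c) (prodFact∣! m c) ⟩
    ((j + s) C j) * (s ! / prodFact m c)
      ≡⟨ cong (((j + s) C j) *_) (multinomial-yes m s c refl) ⟨
    ((j + s) C j) * multinomial m s c
      ≡⟨ cong (λ t → ((j + s) C j) * multinomial m t c) (ℕₚ.m+n∸m≡n j s) ⟨
    ((j + s) C j) * multinomial m (j + s ∸ j) c
      ∎
    where
    open ≡-Reasoning
    s : ℕ
    s = sumFin m c
    instance
      P≢0 : NonZero (prodFact m c)
      P≢0 = prodFact≢0 m c
      j!*P≢0 : NonZero (j ! * prodFact m c)
      j!*P≢0 = prodFact≢0 (suc m) (j ∷ c)
  ... | no j+s≢a = trans (multinomial-no (suc m) a (j ∷ c) j+s≢a) (sym [aCj]*mult≡0)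
    where
    [aCj]*mult≡0 : (a C j) * multinomial m (a ∸ j) c ≡ 0
    [aCj]*mult≡0 with j ≤? a
    ... | yes j≤a = trans (cong ((a C j) *_) (multinomial-no m (a ∸ j) c
                      (λ s≡a∸j → j+s≢a (trans (cong (j +_) s≡a∸j) (ℕₚ.m+[n∸m]≡n j≤a)))))
                      (ℕₚ.*-zeroʳ (a C j))
    ... | no  j≰a = cong (_* multinomial m (a ∸ j) c) (k>n⇒nCk≡0 (≰⇒> j≰a))

  [m+kn]/n≡m/n+k : ∀ m k n .{{_ : NonZero n}} → (m + k * n) / n ≡ m / n + k
  [m+kn]/n≡m/n+k m k n = trans (+-distrib-/-∣ʳ m (n∣m*n k)) (cong (m / n +_) (m*n/n≡m k n))

  module Digits (b : ℕ) where

    B : ℕ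
    B = suc b

    digit<B : ∀ j l → digit B j l < B
    digit<B j l = m%n<n ((j / B ^ l) {{ℕₚ.m^n≢0 B l}}) B

    <B^l⇒digit≡0 : ∀ {j} l → j < B ^ l → digit B j l ≡ 0
    <B^l⇒digit≡0 l j<B^l = cong (_% B) (m<n⇒m/n≡0 {{ℕₚ.m^n≢0 B l}} j<B^l)

    digit-low : ∀ r q {N l} → l < N → digit B (r + q * B ^ N) l ≡ digit B r l
    digit-low r q {N} {l} l<N = begin
      (r + q * B ^ N) / B ^ l % B     ≡⟨ cong (λ t → (r + t) / B ^ l % B) q*B^N≡K*B*B^l ⟩
      (r + K * B * B ^ l) / B ^ l % B ≡⟨ cong (_% B) ([m+kn]/n≡m/n+k r (K * B) (B ^ l)) ⟩
      (r / B ^ l + K * B) % B         ≡⟨ [m+kn]%n≡m%n (r / B ^ l) K B ⟩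
      r / B ^ l % B                   ∎
      where
      open ≡-Reasoning
      instance
        B^l≢0 : NonZero (B ^ l)
        B^l≢0 = ℕₚ.m^n≢0 B l
      K : ℕ
      K = q * B ^ (N ∸ suc l)
      q*B^N≡K*B*B^l : q * B ^ N ≡ K * B * B ^ l
      q*B^N≡K*B*B^l = begin
        q * B ^ N                           ≡⟨ cong (λ e → q * B ^ e) (ℕₚ.m∸n+n≡m l<N) ⟨
        q * B ^ (N ∸ suc l + suc l)         ≡⟨ cong (q *_) (ℕₚ.^-distribˡ-+-* B (N ∸ suc l) (suc l)) ⟩
        q * (B ^ (N ∸ suc l) * (B * B ^ l)) ≡⟨ trans (ℕₚ.*-assoc K B (B ^ l)) (ℕₚ.*-assoc q _ _) ⟨
        K * B * B ^ l                       ∎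

    digit-top : ∀ {r q} N → r < B ^ N → q < B → digit B (r + q * B ^ N) N ≡ q
    digit-top {r} {q} N r<B^N q<B = begin
      (r + q * B ^ N) / B ^ N % B ≡⟨ cong (_% B) ([m+kn]/n≡m/n+k r q (B ^ N)) ⟩
      (r / B ^ N + q) % B         ≡⟨ cong (λ t → (t + q) % B) (m<n⇒m/n≡0 r<B^N) ⟩
      q % B                       ≡⟨ m<n⇒m%n≡m q<B ⟩
      q                           ∎
      where
      open ≡-Reasoning
      instance
        B^N≢0 : NonZero (B ^ N)
        B^N≢0 = ℕₚ.m^n≢0 B N

    digit-expansion : ∀ N j → j < B ^ N → sumℕ N (λ l → digit B j l * B ^ l) ≡ j
    digit-expansion zero    zero    _         = refl
    digit-expansion zero    (suc j) (s≤s ())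
    digit-expansion (suc N) j       j<B^[1+N] = begin
      sumℕ N (λ l → digit B j l * B ^ l) + digit B j N * B ^ N
        ≡⟨ cong (λ t → sumℕ N (λ l → digit B t l * B ^ l) + digit B t N * B ^ N) j≡r+q*B^N ⟩
      sumℕ N (λ l → digit B (r + q * B ^ N) l * B ^ l) + digit B (r + q * B ^ N) N * B ^ N
        ≡⟨ cong₂ (λ s d → s + d * B ^ N)
                 (sumℕ-cong N (λ l l<N → cong (_* B ^ l) (digit-low r q l<N)))
                 (digit-top N r<B^N (m<n*o⇒m/o<n j<B^[1+N])) ⟩
      sumℕ N (λ l → digit B r l * B ^ l) + q * B ^ N
        ≡⟨ cong (_+ q * B ^ N) (digit-expansion N r r<B^N) ⟩
      r + q * B ^ N
        ≡⟨ j≡r+q*B^N ⟨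
      j ∎
      where
      open ≡-Reasoning
      instance
        B^N≢0 : NonZero (B ^ N)
        B^N≢0 = ℕₚ.m^n≢0 B N
      r q : ℕ
      r = j % B ^ N
      q = j / B ^ N
      r<B^N : r < B ^ N
      r<B^N = m%n<n j (B ^ N)
      j≡r+q*B^N : j ≡ r + q * B ^ N
      j≡r+q*B^N = m≡m%n+[m/n]*n j (B ^ N)

    digitwise-≤ : ∀ {N j k} → j < B ^ N → k < B ^ N →
      (∀ l → l < N → digit B k l ≤ digit B j l) → k ≤ j
    digitwise-≤ {N} {j} {k} j<B^N k<B^N k≤j =
      subst₂ _≤_ (digit-expansion N k k<B^N) (digit-expansion N j j<B^N)
        (sumℕ-mono-≤ N (λ l l<N → ℕₚ.*-monoˡ-≤ (B ^ l) (k≤j l l<N)))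

    n<B^n : 1 < B → ∀ n → n < B ^ n
    n<B^n 1<B zero    = s≤s z≤n
    n<B^n 1<B (suc n) = ≤-<-trans (n<B^n 1<B n) (ℕₚ.^-monoʳ-< B 1<B (ℕₚ.n<1+n n))

    private
      count : ℕ → ℕ → ℕ
      count n M = sumℕ M (λ l → if does (B ^ l ≤? n) then 1 else 0)

      count-yes : ∀ n M → B ^ M ≤ n → count n (suc M) ≡ suc (count n M)
      count-yes n M B^M≤n =
        trans (cong (λ t → count n M + (if t then 1 else 0)) (dec-true (B ^ M ≤? n) B^M≤n))
              (ℕₚ.+-comm (count n M) 1)

      count-no : ∀ n M → B ^ M ≰ n → count n (suc M) ≡ count n M
      count-no n M B^M≰n =
        trans (cong (λ t → count n M + (if t then 1 else 0)) (dec-false (B ^ M ≤? n) B^M≰n))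
              (ℕₚ.+-identityʳ (count n M))

      count≤ : ∀ n M → count n M ≤ M
      count≤ n zero    = z≤n
      count≤ n (suc M) with B ^ M ≤? n
      ... | yes B^M≤n = subst (_≤ suc M) (sym (count-yes n M B^M≤n)) (s≤s (count≤ n M))
      ... | no  B^M≰n = subst (_≤ suc M) (sym (count-no n M B^M≰n)) (ℕₚ.m≤n⇒m≤1+n (count≤ n M))

      -- The l with B ^ l ≤ n form an initial segment of ℕ.
      n<B^count⊎count≡M : ∀ n M → n < B ^ count n M ⊎ count n M ≡ M
      n<B^count⊎count≡M n zero = inj₂ refl
      n<B^count⊎count≡M n (suc M) with n<B^count⊎count≡M n M | B ^ M ≤? n
      ... | inj₁ n<B^c | yes B^M≤n =
        ⊥-elim (ℕₚ.<⇒≱ n<B^c (≤-trans (ℕₚ.^-monoʳ-≤ B (count≤ n M)) B^M≤n))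
      ... | inj₁ n<B^c | no  B^M≰n = inj₁ (subst (λ c → n < B ^ c) (sym (count-no n M B^M≰n)) n<B^c)
      ... | inj₂ c≡M   | yes B^M≤n = inj₂ (trans (count-yes n M B^M≤n) (cong suc c≡M))
      ... | inj₂ c≡M   | no  B^M≰n =
        inj₁ (subst (λ c → n < B ^ c) (sym (trans (count-no n M B^M≰n) c≡M)) (≰⇒> B^M≰n))

    <B^numDigits : 1 < B → ∀ n → n < B ^ numDigits B n
    <B^numDigits 1<B n with n<B^count⊎count≡M n (suc n)
    ... | inj₁ n<B^c = n<B^c
    ... | inj₂ c≡1+n = subst (λ c → n < B ^ c) (sym c≡1+n) (ℕₚ.<-trans (ℕₚ.n<1+n n) (n<B^n 1<B (suc n)))

    sumℕ-digit-extend : ∀ {j L} M → L ≤ M → j < B ^ L → sumℕ M (digit B j) ≡ sumℕ L (digit B j)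
    sumℕ-digit-extend M L≤M j<B^L =
      sumℕ-extend M _ L≤M (λ l L≤l → <B^l⇒digit≡0 l (<-≤-trans j<B^L (ℕₚ.^-monoʳ-≤ B L≤l)))

    digitSum≡sumℕ-digit : 1 < B → ∀ {j} L → j < B ^ L → digitSum B j ≡ sumℕ L (digit B j)
    digitSum≡sumℕ-digit 1<B {j} L j<B^L with ℕₚ.≤-total (numDigits B j) L
    ... | inj₁ D≤L = sym (sumℕ-digit-extend L D≤L (<B^numDigits 1<B j))
    ... | inj₂ L≤D = sumℕ-digit-extend (numDigits B j) L≤D j<B^L

    sumℕ-digit-split : ∀ N {r q} → r < B ^ N → q < B →
      sumℕ (suc N) (digit B (r + q * B ^ N)) ≡ sumℕ N (digit B r) + q
    sumℕ-digit-split N {r} {q} r<B^N q<B =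
      cong₂ _+_ (sumℕ-cong N (λ l l<N → digit-low r q l<N)) (digit-top N r<B^N q<B)

    digitMultinomial : ∀ m → ℕ → (ℕ → ℕ) → (Fin m → ℕ) → ℕ
    digitMultinomial m N d k = prodℕ N (λ l → multinomial m (d l) (λ i → digit B (k i) l))

    digitMultinomial-cong : ∀ m N d {k k' : Fin m → ℕ} → k ≗ k' →
      digitMultinomial m N d k ≡ digitMultinomial m N d k'
    digitMultinomial-cong m N d k≗k' =
      prodℕ-cong N (λ l _ → multinomial-cong m (d l) (λ i → cong (λ x → digit B x l) (k≗k' i)))

    digitMultinomial-split : ∀ m N d {r q : Fin m → ℕ} → (∀ i → r i < B ^ N) → (∀ i → q i < B) →
      digitMultinomial m (suc N) d (λ i → r i + q i * B ^ N)
        ≡ digitMultinomial m N d r * multinomial m (d N) q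
    digitMultinomial-split m N d {r} {q} r<B^N q<B = cong₂ _*_
      (prodℕ-cong N (λ l l<N → multinomial-cong m (d l) (λ i → digit-low (r i) (q i) l<N)))
      (multinomial-cong m (d N) (λ i → digit-top N (r<B^N i) (q<B i)))

    digitMultinomial≡0 : ∀ m N {n} (k : Fin m → ℕ) i → n < B ^ N → k i < B ^ N → n < k i →
      digitMultinomial m N (digit B n) k ≡ 0
    digitMultinomial≡0 m N {n} k i n<B^N kᵢ<B^N n<kᵢ with digitMultinomial m N (digit B n) k ≟ 0
    ... | yes ≡0 = ≡0
    ... | no  ≢0 = ⊥-elim (ℕₚ.<⇒≱ n<kᵢ (digitwise-≤ n<B^N kᵢ<B^N kᵢ≤n))
      where
      kᵢ≤n : ∀ l → l < N → digit B (k i) l ≤ digit B n l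
      kᵢ≤n l l<N = subst (digit B (k i) l ≤_)
        (multinomial≢0⇒sumFin≡ m (digit B n l) _ (prodℕ≢0⇒≢0 N _ ≢0 l l<N))
        (≤-sumFin m (λ i → digit B (k i) l) i)

module RingSums {c ℓ : Level} (R : CommutativeRing c ℓ) where

  open CommutativeRing R hiding (zero) renaming (refl to ≈-refl; sym to ≈-sym; trans to ≈-trans)
  open import Algebra.Properties.Semiring.Mult semiring
    using (_×_; ×-congʳ; ×-cong; ×-assoc-*; ×-comm-*; ×-assocˡ)
  open import Algebra.Properties.Semiring.Exp semiring using (_^_; ^-homo-*)
  open import Algebra.Properties.Semiring.Sum semiring using (sum; sum-init-last; sum-cong-≗)
  open import Algebra.Properties.CommutativeSemiring.Binomial commutativeSemiring
    using () renaming (theorem to binomial)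
  open import Algebra.Properties.CommutativeSemigroup *-commutativeSemigroup
    using () renaming (interchange to *-interchange)
  open import Algebra.Properties.CommutativeSemigroup +-commutativeSemigroup
    using () renaming (interchange to +-interchange)
  open import Relation.Binary.Reasoning.Setoid setoid

  ×-*-interchange : ∀ p q x y → (p Nat.* q) × (x * y) ≈ (p × x) * (q × y)
  ×-*-interchange p q x y = begin
    (p Nat.* q) × (x * y) ≈⟨ ×-assocˡ (x * y) p q ⟨
    p × (q × (x * y))     ≈⟨ ×-congʳ p (×-comm-* q x y) ⟨
    p × (x * (q × y))     ≈⟨ ×-assoc-* p x (q × y) ⟨
    (p × x) * (q × y)     ∎

  finProd-cong : ∀ m {f g : Fin m → Carrier} → (∀ i → f i ≈ g i) → finProd R m f ≈ finProd R m g
  finProd-cong zero    f≈g = ≈-refl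
  finProd-cong (suc m) f≈g = *-cong (f≈g zero) (finProd-cong m (f≈g ∘ suc))

  finProd-* : ∀ m (f g : Fin m → Carrier) → finProd R m (λ i → f i * g i) ≈ finProd R m f * finProd R m g
  finProd-* zero    f g = ≈-sym (*-identityʳ 1#)
  finProd-* (suc m) f g = ≈-trans (*-congˡ (finProd-* m (f ∘ suc) (g ∘ suc))) (*-interchange _ _ _ _)

  finProd-1 : ∀ m → finProd R m (λ _ → 1#) ≈ 1#
  finProd-1 zero    = ≈-refl
  finProd-1 (suc m) = ≈-trans (*-identityˡ _) (finProd-1 m)

  monomial : ∀ {m} → (Fin m → Carrier) → (Fin m → ℕ) → Carrier
  monomial {m} X c = finProd R m (λ i → X i ^ c i)

  monomial-cong : ∀ {m} (X : Fin m → Carrier) {c c'} → c ≗ c' → monomial X c ≈ monomial X c'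
  monomial-cong {m} X c≗c' = finProd-cong m (λ i → reflexive (cong (X i ^_) (c≗c' i)))

  monomial-+ : ∀ {m} (X : Fin m → Carrier) c c' →
    monomial X (λ i → c i Nat.+ c' i) ≈ monomial X c * monomial X c'
  monomial-+ {m} X c c' = ≈-trans (finProd-cong m (λ i → ^-homo-* (X i) (c i) (c' i))) (finProd-* m _ _)

  ×-monomial-cong : ∀ {m} (X : Fin m → Carrier) (C : (Fin m → ℕ) → ℕ) (e : ℕ → ℕ) →
    (∀ {k k'} → k ≗ k' → C k ≡ C k') → (λ k → C k × monomial X (e ∘ k)) Preserves _≗_ ⟶ _≈_
  ×-monomial-cong X C e C-cong k≗k' = ×-cong (C-cong k≗k') (monomial-cong X (cong e ∘ k≗k'))

  rangeSum-cong : ∀ N {f g : ℕ → Carrier} → (∀ j → j < N → f j ≈ g j) → rangeSum R N f ≈ rangeSum R N g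
  rangeSum-cong zero    f≈g = ≈-refl
  rangeSum-cong (suc N) f≈g = +-cong (rangeSum-cong N (λ j j<N → f≈g j (m<n⇒m<1+n j<N))) (f≈g N ≤-refl)

  rangeSum-vanishes : ∀ N {f : ℕ → Carrier} → (∀ j → j < N → f j ≈ 0#) → rangeSum R N f ≈ 0#
  rangeSum-vanishes zero    f≈0 = ≈-refl
  rangeSum-vanishes (suc N) f≈0 =
    ≈-trans (+-cong (rangeSum-vanishes N (λ j j<N → f≈0 j (m<n⇒m<1+n j<N))) (f≈0 N ≤-refl))
            (+-identityʳ 0#)

  rangeSum-+ : ∀ N (f g : ℕ → Carrier) → rangeSum R N (λ j → f j + g j) ≈ rangeSum R N f + rangeSum R N g
  rangeSum-+ zero    f g = ≈-sym (+-identityʳ 0#)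
  rangeSum-+ (suc N) f g = ≈-trans (+-congʳ (rangeSum-+ N f g)) (+-interchange _ _ _ _)

  rangeSum-*ˡ : ∀ N x (f : ℕ → Carrier) → x * rangeSum R N f ≈ rangeSum R N (λ j → x * f j)
  rangeSum-*ˡ zero    x f = zeroʳ x
  rangeSum-*ˡ (suc N) x f = ≈-trans (distribˡ x _ _) (+-congʳ (rangeSum-*ˡ N x f))

  rangeSum-swap : ∀ N M (f : ℕ → ℕ → Carrier) →
    rangeSum R N (λ i → rangeSum R M (f i)) ≈ rangeSum R M (λ j → rangeSum R N (λ i → f i j))
  rangeSum-swap zero    M f = ≈-sym (rangeSum-vanishes M (λ _ _ → ≈-refl))
  rangeSum-swap (suc N) M f = ≈-trans (+-congʳ (rangeSum-swap N M f)) (≈-sym (rangeSum-+ M _ _))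

  rangeSum-split : ∀ y x (g : ℕ → Carrier) →
    rangeSum R (y Nat.+ x) g ≈ rangeSum R x g + rangeSum R y (λ r → g (r Nat.+ x))
  rangeSum-split zero    x g = ≈-sym (+-identityʳ _)
  rangeSum-split (suc y) x g = ≈-trans (+-congʳ (rangeSum-split y x g)) (+-assoc _ _ _)

  rangeSum-reindex : ∀ a B (g : ℕ → Carrier) →
    rangeSum R (a Nat.* B) g ≈ rangeSum R a (λ q → rangeSum R B (λ r → g (r Nat.+ q Nat.* B)))
  rangeSum-reindex zero    B g = ≈-refl
  rangeSum-reindex (suc a) B g = ≈-trans (rangeSum-split B (a Nat.* B) g) (+-congʳ (rangeSum-reindex a B g))

  rangeSum-extend : ∀ {L} M (g : ℕ → Carrier) → L ≤ M → (∀ j → L ≤ j → j < M → g j ≈ 0#) →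
    rangeSum R M g ≈ rangeSum R L g
  rangeSum-extend zero    g z≤n     _   = ≈-refl
  rangeSum-extend (suc M) g L≤1+M g≈0 with m≤n⇒m<n∨m≡n L≤1+M
  ... | inj₂ refl      = ≈-refl
  ... | inj₁ (s≤s L≤M) =
    ≈-trans (+-cong (rangeSum-extend M g L≤M (λ j L≤j j<M → g≈0 j L≤j (m<n⇒m<1+n j<M))) (g≈0 M L≤M ≤-refl))
            (+-identityʳ _)

  rangeSum≈sum : ∀ N (g : ℕ → Carrier) → rangeSum R N g ≈ sum {N} (g ∘ toℕ)
  rangeSum≈sum zero    g = ≈-refl
  rangeSum≈sum (suc N) g = begin
    rangeSum R N g + g N                       ≈⟨ +-congʳ (rangeSum≈sum N g) ⟩
    sum {N} (g ∘ toℕ) + g N                    ≡⟨ cong₂ _+_ (sum-cong-≗ {N} (λ i → cong g (sym (toℕ-inject₁ i))))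
                                                            (cong g (sym (toℕ-fromℕ N))) ⟩
    sum {N} (g ∘ toℕ ∘ inject₁) + g (toℕ (fromℕ N)) ≈⟨ sum-init-last (g ∘ toℕ) ⟨
    sum {suc N} (g ∘ toℕ)                      ∎

  binomial-theorem : ∀ a x y →
    (x + y) ^ a ≈ rangeSum R (suc a) (λ j → (a C j) × (x ^ j * y ^ (a Nat.∸ j)))
  binomial-theorem a x y = ≈-trans (binomial a x y) (≈-sym (rangeSum≈sum (suc a) _))

  cubeSum : ∀ m → ℕ → ((Fin m → ℕ) → Carrier) → Carrier
  cubeSum zero    B F = F []
  cubeSum (suc m) B F = rangeSum R B (λ j → cubeSum m B (F ∘ (j ∷_)))

  cubeSum-cong : ∀ m B {F G : (Fin m → ℕ) → Carrier} → (∀ k → (∀ i → k i < B) → F k ≈ G k) →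
    cubeSum m B F ≈ cubeSum m B G
  cubeSum-cong zero    B F≈G = F≈G [] (λ ())
  cubeSum-cong (suc m) B F≈G = rangeSum-cong B (λ j j<B → cubeSum-cong m B (λ k k<B →
    F≈G (j ∷ k) (λ { zero → j<B ; (suc i) → k<B i })))

  cubeSum-vanishes : ∀ m B {F : (Fin m → ℕ) → Carrier} → (∀ k → (∀ i → k i < B) → F k ≈ 0#) →
    cubeSum m B F ≈ 0#
  cubeSum-vanishes zero    B F≈0 = F≈0 [] (λ ())
  cubeSum-vanishes (suc m) B F≈0 = rangeSum-vanishes B (λ j j<B → cubeSum-vanishes m B (λ k k<B →
    F≈0 (j ∷ k) (λ { zero → j<B ; (suc i) → k<B i })))

  cubeSum-*ˡ : ∀ m B x (F : (Fin m → ℕ) → Carrier) → x * cubeSum m B F ≈ cubeSum m B (λ k → x * F k)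
  cubeSum-*ˡ zero    B x F = ≈-refl
  cubeSum-*ˡ (suc m) B x F = ≈-trans (rangeSum-*ˡ B x _) (rangeSum-cong B (λ j _ → cubeSum-*ˡ m B x _))

  cubeSum-*ʳ : ∀ m B x (F : (Fin m → ℕ) → Carrier) → cubeSum m B F * x ≈ cubeSum m B (λ k → F k * x)
  cubeSum-*ʳ m B x F =
    ≈-trans (*-comm _ x) (≈-trans (cubeSum-*ˡ m B x F) (cubeSum-cong m B (λ k _ → *-comm x (F k))))

  cubeSum-*-cubeSum : ∀ m A B (F G : (Fin m → ℕ) → Carrier) →
    cubeSum m A F * cubeSum m B G ≈ cubeSum m B (λ q → cubeSum m A (λ r → F r * G q))
  cubeSum-*-cubeSum m A B F G =
    ≈-trans (cubeSum-*ˡ m B _ G) (cubeSum-cong m B (λ q _ → cubeSum-*ʳ m A (G q) F))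

  rangeSum-cubeSum-swap : ∀ m N B (G : ℕ → (Fin m → ℕ) → Carrier) →
    rangeSum R N (λ j → cubeSum m B (G j)) ≈ cubeSum m B (λ k → rangeSum R N (λ j → G j k))
  rangeSum-cubeSum-swap zero    N B G = ≈-refl
  rangeSum-cubeSum-swap (suc m) N B G =
    ≈-trans (rangeSum-swap N B _) (rangeSum-cong B (λ j _ → rangeSum-cubeSum-swap m N B _))

  cubeSum-const : ∀ m x → cubeSum m 1 (λ _ → x) ≈ x
  cubeSum-const zero    x = ≈-refl
  cubeSum-const (suc m) x = ≈-trans (+-identityˡ _) (cubeSum-const m x)

  cubeSum-extend : ∀ m {L} M (F : (Fin m → ℕ) → Carrier) → L ≤ M →
    (∀ k → (∀ i → k i < M) → ∃ (λ i → L ≤ k i) → F k ≈ 0#) → cubeSum m M F ≈ cubeSum m L F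
  cubeSum-extend zero    M F L≤M F≈0 = ≈-refl
  cubeSum-extend (suc m) M F L≤M F≈0 = ≈-trans
    (rangeSum-extend M _ L≤M (λ j L≤j j<M → cubeSum-vanishes m M (λ k k<M →
      F≈0 (j ∷ k) (λ { zero → j<M ; (suc i) → k<M i }) (zero , L≤j))))
    (rangeSum-cong _ (λ j j<L → cubeSum-extend m M _ L≤M (λ k k<M (i , L≤kᵢ) →
      F≈0 (j ∷ k) (λ { zero → <-≤-trans j<L L≤M ; (suc i) → k<M i }) (suc i , L≤kᵢ))))

  cubeSum-reindex : ∀ m a B (F : (Fin m → ℕ) → Carrier) → F Preserves _≗_ ⟶ _≈_ →
    cubeSum m (a Nat.* B) F ≈ cubeSum m a (λ q → cubeSum m B (λ r → F (λ i → r i Nat.+ q i Nat.* B)))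
  cubeSum-reindex zero    a B F F-cong = F-cong (λ ())
  cubeSum-reindex (suc m) a B F F-cong = begin
    rangeSum R (a Nat.* B) (λ j → cubeSum m (a Nat.* B) (F ∘ (j ∷_)))
      ≈⟨ rangeSum-cong (a Nat.* B) (λ j _ → cubeSum-reindex m a B (F ∘ (j ∷_)) (F-cong ∘ ∷-cong j)) ⟩
    rangeSum R (a Nat.* B) (λ j → cubeSum m a (λ q → cubeSum m B (λ r →
      F (j ∷ (λ i → r i Nat.+ q i Nat.* B)))))
      ≈⟨ rangeSum-reindex a B _ ⟩
    rangeSum R a (λ q₀ → rangeSum R B (λ r₀ → cubeSum m a (λ q → cubeSum m B (λ r →
      F ((r₀ Nat.+ q₀ Nat.* B) ∷ (λ i → r i Nat.+ q i Nat.* B))))))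
      ≈⟨ rangeSum-cong a (λ q₀ _ → rangeSum-cubeSum-swap m B a _) ⟩
    rangeSum R a (λ q₀ → cubeSum m a (λ q → rangeSum R B (λ r₀ → cubeSum m B (λ r →
      F ((r₀ Nat.+ q₀ Nat.* B) ∷ (λ i → r i Nat.+ q i Nat.* B))))))
      ≈⟨ rangeSum-cong a (λ q₀ _ → cubeSum-cong m a (λ q _ → rangeSum-cong B (λ r₀ _ →
           cubeSum-cong m B (λ r _ → F-cong (λ { zero → refl ; (suc i) → refl }))))) ⟩
    cubeSum (suc m) a (λ q → cubeSum (suc m) B (λ r → F (λ i → r i Nat.+ q i Nat.* B))) ∎
    where
    ∷-cong : ∀ {m} j {k k' : Fin m → ℕ} → k ≗ k' → (j ∷ k) ≗ (j ∷ k')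
    ∷-cong j k≗k' zero    = refl
    ∷-cong j k≗k' (suc i) = k≗k' i

  boxSum≈cubeSum : ∀ m n (F : (Fin m → ℕ) → Carrier) → F Preserves _≗_ ⟶ _≈_ →
    boxSum R m n F ≈ cubeSum m (suc n) F
  boxSum≈cubeSum zero    n F F-cong = F-cong (λ ())
  boxSum≈cubeSum (suc m) n F F-cong = rangeSum-cong (suc n) (λ j _ → ≈-trans
    (boxSum≈cubeSum m n _ (λ k≗k' → F-cong (λ { zero → refl ; (suc i) → k≗k' i })))
    (cubeSum-cong m (suc n) (λ k _ → F-cong (λ { zero → refl ; (suc i) → refl }))))

  multinomialTerm : ∀ m → ℕ → (Fin m → Carrier) → (Fin m → ℕ) → Carrier
  multinomialTerm m a X c = multinomial m a c × monomial X c

  multinomialTerm-cons : ∀ m a X j (c : Fin m → ℕ) →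
    multinomialTerm (suc m) a X (j ∷ c)
      ≈ ((a C j) × X zero ^ j) * multinomialTerm m (a Nat.∸ j) (X ∘ suc) c
  multinomialTerm-cons m a X j c = begin
    multinomial (suc m) a (j ∷ c) × (X zero ^ j * monomial (X ∘ suc) c)
      ≡⟨ cong (_× _) (multinomial-cons m a j c) ⟩
    ((a C j) Nat.* multinomial m (a Nat.∸ j) c) × (X zero ^ j * monomial (X ∘ suc) c)
      ≈⟨ ×-*-interchange (a C j) _ _ _ ⟩
    ((a C j) × X zero ^ j) * multinomialTerm m (a Nat.∸ j) (X ∘ suc) c ∎

  -- Restricting each c_i to [0, B) loses nothing since the coefficient vanishes unless c_i ≤ a < B.
  multinomial-theorem : ∀ m {a B} → a < B → (X : Fin m → Carrier) →
    finSum R m X ^ a ≈ cubeSum m B (multinomialTerm m a X)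
  multinomial-theorem zero    {zero}  _   X = ≈-sym (+-identityʳ 1#)
  multinomial-theorem zero    {suc a} _   X = zeroˡ _
  multinomial-theorem (suc m) {a} {B} a<B X = begin
    (X zero + S) ^ a                                    ≈⟨ binomial-theorem a (X zero) S ⟩
    rangeSum R (suc a) binomialTerm                     ≈⟨ rangeSum-extend B _ a<B binomialTerm≈0 ⟨
    rangeSum R B binomialTerm                           ≈⟨ rangeSum-cong B (λ j _ → binomialTerm≈cubeSum j) ⟩
    cubeSum (suc m) B (multinomialTerm (suc m) a X)     ∎
    where
    S : Carrier
    S = finSum R m (X ∘ suc)

    binomialTerm : ℕ → Carrier
    binomialTerm j = (a C j) × (X zero ^ j * S ^ (a Nat.∸ j))

    binomialTerm≈0 : ∀ j → suc a ≤ j → j < B → binomialTerm j ≈ 0#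
    binomialTerm≈0 j a<j _ = ×-cong (k>n⇒nCk≡0 a<j) ≈-refl

    binomialTerm≈cubeSum : ∀ j → binomialTerm j ≈ cubeSum m B (multinomialTerm (suc m) a X ∘ (j ∷_))
    binomialTerm≈cubeSum j = begin
      (a C j) × (X zero ^ j * S ^ (a Nat.∸ j))
        ≈⟨ ×-assoc-* (a C j) _ _ ⟨
      ((a C j) × X zero ^ j) * S ^ (a Nat.∸ j)
        ≈⟨ *-congˡ (multinomial-theorem m (≤-<-trans (ℕₚ.m∸n≤m a j) a<B) (X ∘ suc)) ⟩
      ((a C j) × X zero ^ j) * cubeSum m B (multinomialTerm m (a Nat.∸ j) (X ∘ suc))
        ≈⟨ cubeSum-*ˡ m B _ _ ⟩
      cubeSum m B (λ c → ((a C j) × X zero ^ j) * multinomialTerm m (a Nat.∸ j) (X ∘ suc) c)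
        ≈⟨ cubeSum-cong m B (λ c _ → multinomialTerm-cons m a X j c) ⟨
      cubeSum m B (multinomialTerm (suc m) a X ∘ (j ∷_)) ∎

  module DigitExpansion (b : ℕ) where
    open Digits b

    digitTerm : ∀ m → ℕ → (ℕ → ℕ) → (Fin m → Carrier) → (Fin m → ℕ) → Carrier
    digitTerm m N d X k = digitMultinomial m N d k × monomial X (λ i → sumℕ N (digit B (k i)))

    digitTerm-cong : ∀ m N d X → digitTerm m N d X Preserves _≗_ ⟶ _≈_
    digitTerm-cong m N d X = ×-monomial-cong X (digitMultinomial m N d) (λ j → sumℕ N (digit B j))
                                             (digitMultinomial-cong m N d)

    digitTerm-split : ∀ m N d X {r q : Fin m → ℕ} → (∀ i → r i < B Nat.^ N) → (∀ i → q i < B) →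
      digitTerm m (suc N) d X (λ i → r i Nat.+ q i Nat.* B Nat.^ N)
        ≈ digitTerm m N d X r * multinomialTerm m (d N) X q
    digitTerm-split m N d X {r} {q} r<B^N q<B = begin
      digitMultinomial m (suc N) d (λ i → r i Nat.+ q i Nat.* B Nat.^ N)
        × monomial X (λ i → sumℕ (suc N) (digit B (r i Nat.+ q i Nat.* B Nat.^ N)))
        ≈⟨ ×-cong (digitMultinomial-split m N d r<B^N q<B)
                  (monomial-cong X (λ i → sumℕ-digit-split N (r<B^N i) (q<B i))) ⟩
      (digitMultinomial m N d r Nat.* multinomial m (d N) q)
        × monomial X (λ i → sumℕ N (digit B (r i)) Nat.+ q i)
        ≈⟨ ×-congʳ (digitMultinomial m N d r Nat.* multinomial m (d N) q)
                   (monomial-+ X (λ i → sumℕ N (digit B (r i))) q) ⟩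
      (digitMultinomial m N d r Nat.* multinomial m (d N) q)
        × (monomial X (λ i → sumℕ N (digit B (r i))) * monomial X q)
        ≈⟨ ×-*-interchange (digitMultinomial m N d r) (multinomial m (d N) q) _ _ ⟩
      digitTerm m N d X r * multinomialTerm m (d N) X q ∎

    digit-multinomial-theorem : ∀ m N d → (∀ l → d l < B) → (X : Fin m → Carrier) →
      finSum R m X ^ sumℕ N d ≈ cubeSum m (B Nat.^ N) (digitTerm m N d X)
    digit-multinomial-theorem m zero    d d<B X = begin
      1#                                  ≈⟨ finProd-1 m ⟨
      finProd R m (λ _ → 1#)              ≈⟨ +-identityʳ _ ⟨
      1 × finProd R m (λ _ → 1#)          ≈⟨ cubeSum-const m _ ⟨
      cubeSum m 1 (digitTerm m zero d X)  ∎
    digit-multinomial-theorem m (suc N) d d<B X = begin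
      S ^ (sumℕ N d Nat.+ d N)
        ≈⟨ ^-homo-* S (sumℕ N d) (d N) ⟩
      S ^ sumℕ N d * S ^ d N
        ≈⟨ *-cong (digit-multinomial-theorem m N d d<B X) (multinomial-theorem m (d<B N) X) ⟩
      cubeSum m (B Nat.^ N) (digitTerm m N d X) * cubeSum m B (multinomialTerm m (d N) X)
        ≈⟨ cubeSum-*-cubeSum m (B Nat.^ N) B _ _ ⟩
      cubeSum m B (λ q → cubeSum m (B Nat.^ N) (λ r → digitTerm m N d X r * multinomialTerm m (d N) X q))
        ≈⟨ cubeSum-cong m B (λ q q<B → cubeSum-cong m (B Nat.^ N) (λ r r<B^N →
             digitTerm-split m N d X r<B^N q<B)) ⟨
      cubeSum m B (λ q → cubeSum m (B Nat.^ N) (λ r →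
        digitTerm m (suc N) d X (λ i → r i Nat.+ q i Nat.* B Nat.^ N)))
        ≈⟨ cubeSum-reindex m B (B Nat.^ N) _ (digitTerm-cong m (suc N) d X) ⟨
      cubeSum m (B Nat.^ suc N) (digitTerm m (suc N) d X) ∎
      where
      S : Carrier
      S = finSum R m X

theorem4p2 : ∀ {c ℓ : Level} (R : CommutativeRing c ℓ) (b m n : ℕ) → 2 ≤ b → 1 ≤ m →
    (X : Fin m → CommutativeRing.Carrier R) →
    CommutativeRing._≈_ R
      (pow R (finSum R m X) (digitSum b n))
      (boxSum R m n (λ k → natMul R (baseMultinomial b m n k)
                                (finProd R m (λ i → pow R (X i) (digitSum b (k i))))))
theorem4p2 R (suc b) m n 1<B _ X = begin
  finSum R m X ^ digitSum B n
    ≈⟨ digit-multinomial-theorem m N (digit B n) (digit<B n) X ⟩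
  cubeSum m (B Nat.^ N) (digitTerm m N (digit B n) X)
    ≈⟨ cubeSum-extend m (B Nat.^ N) _ n<B^N (λ k k<B^N (i , n<kᵢ) →
         ×-congˡ (digitMultinomial≡0 m N k i n<B^N (k<B^N i) n<kᵢ)) ⟩
  cubeSum m (suc n) (digitTerm m N (digit B n) X)
    ≈⟨ cubeSum-cong m (suc n) (λ k k≤n → ×-congʳ (baseMultinomial B m n k) (monomial-cong X (λ i →
         sym (digitSum≡sumℕ-digit 1<B N (<-≤-trans (k≤n i) n<B^N))))) ⟩
  cubeSum m (suc n) G
    ≈⟨ boxSum≈cubeSum m n G (×-monomial-cong X (baseMultinomial B m n) (digitSum B)
                                              (digitMultinomial-cong m N (digit B n))) ⟨
  boxSum R m n G ∎
  where
  open CommutativeRing R using (Carrier; setoid)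
  open import Relation.Binary.Reasoning.Setoid setoid
  open import Algebra.Properties.Semiring.Mult (CommutativeRing.semiring R) using (_×_; ×-congˡ; ×-congʳ)
  open import Algebra.Properties.Semiring.Exp (CommutativeRing.semiring R) using (_^_)
  open Digits b
  open RingSums R
  open DigitExpansion b
  N : ℕ
  N = numDigits B n
  n<B^N : n < B Nat.^ N
  n<B^N = <B^numDigits 1<B n
  G : (Fin m → ℕ) → Carrier
  G k = baseMultinomial B m n k × monomial X (λ i → digitSum B (k i))
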